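{- Let $R$ be a commutative ring with $1$ and $\mathcal{A}$ a set of non-commuting symbols. Let $D_{\mathcal{A}}$ be an $R$-valued multiple Dedekind symbol based on $\mathcal{A}$ with associated function $F_{\mathcal{A}}(p,q)=D_{\mathcal{A}}(p,q)D_{\mathcal{A}}(-q,p)^{ -1}$. Then there exists a unique normalized $R$-valued multiple Dedekind symbol $\widetilde{D}_{\mathcal{A}}$ based on $\mathcal{A}$ whose associated function is also $F_{\mathcal{A}}$, i.e. $\widetilde{D}_{\mathcal{A}}(p,q)\widetilde{D}_{\mathcal{A}}(-q,p)^{ -1}=F_{\mathcal{A}}(p,q)$ for all $(p,q)\in U$.
   Context: $\mathcal{A}^{*}$ denotes the set of words in $\mathcal{A}$ (including the empty word $\emptyset$), with concatenation product; $l(w)$ is the length of $w$. $R\langle\langle\mathcal{A}\rangle\rangle$ is the ring of formal power series $\sum_{w\in\mathcal{A}^*}c_w w$ ($c_w\in R$) in the non-commuting symbols, and $R\langle\langle\mathcal{A}\rangle\rangle^{\times}$ its group of units. Let $U=\{(p,q)\in\mathbb{Z}^2:\gcd(p,q)=1\}$. For a group $G$, a $G$-valued Dedekind symbol is a map $D:U\to G$ with $D(p,-q)=D(-p,q)$ and $D(p,q)=D(p,p+q)$ for all $(p,q)\in U$. An $R$-valued multiple Dedekind symbol based on $\mathcal{A}$ is an $R\langle\langle\mathcal{A}\rangle\rangle^{\times}$-valued Dedekind symbol of the form $D_{\mathcal{A}}(p,q)=1+\sum_{\emptyset\neq w\in\mathcal{A}^*}D^{w}(p,q)w$ with $D^w:U\to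 R$; it is normalized if $D_{\mathcal{A}}(1,1)=1$. -}

module Defs where

open import Level using (Level; _⊔_)
open import Data.Nat using (ℕ; zero; suc)
open import Data.List using (List; []; _∷_; map; foldr; length)
open import Data.Product using (_×_; _,_; Σ)
open import Data.Integer using (ℤ; -_; _+_; 1ℤ)
open import Data.Integer.Coprimality using (Coprime)
open import Algebra.Bundles using (CommutativeRing)

InU : ℤ → ℤ → Set
InU p q = Coprime p q

-- Formal power series R⟨⟨A⟩⟩ in non-commuting symbols A over a commutative ring R,
-- represented by their coefficient function on words (lists over A).
module PowerSeries {c ℓ a : Level} (R : CommutativeRing c ℓ) (A : Set a) where
  open CommutativeRing R renaming (Carrier to K; _+_ to _+ᴿ_; _*_ to _*ᴿ_; -_ to -ᴿ_)

  Word : Set a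
  Word = List A

  Series : Set (a ⊔ c)
  Series = Word → K

  _≈ₛ_ : Series → Series → Set (a ⊔ ℓ)
  f ≈ₛ g = ∀ w → f w ≈ g w

  splits : Word → List (Word × Word)
  splits [] = ([] , []) ∷ []
  splits (x ∷ w) = ([] , x ∷ w) ∷ map (λ { (u , v) → (x ∷ u , v) }) (splits w)

  sumᴿ : List K → K
  sumᴿ = foldr _+ᴿ_ 0#

  oneₛ : Series
  oneₛ [] = 1#
  oneₛ (_ ∷ _) = 0#

  _*ₛ_ : Series → Series → Series
  (f *ₛ g) w = sumᴿ (map (λ { (u , v) → f u *ᴿ g v }) (splits w))

  -- inverse of a series with constant term 1:
  -- g(∅) = 1, g(x w) = - Σ_{w = u v} f(x u) g(v)   (fuel = length of the word)
  invAux : ℕ → Series → Series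
  invAux _ f [] = 1#
  invAux zero f (x ∷ w) = 0#
  invAux (suc n) f (x ∷ w) =
    -ᴿ sumᴿ (map (λ { (u , v) → f (x ∷ u) *ᴿ invAux n f v }) (splits w))

  invₛ : Series → Series
  invₛ f w = invAux (length w) f w

  -- R-valued multiple Dedekind symbol based on A (values off U are irrelevant)
  record IsMultipleDedekindSymbol (D : ℤ → ℤ → Series) : Set (a ⊔ ℓ) where
    field
      constant-one : ∀ p q → InU p q → D p q [] ≈ 1#
      neg-sym      : ∀ p q → InU p q → D p (- q) ≈ₛ D (- p) q
      shift        : ∀ p q → InU p q → D p q ≈ₛ D p (p + q)

  Normalized : (ℤ → ℤ → Series) → Set (a ⊔ ℓ)
  Normalized D = D 1ℤ 1ℤ ≈ₛ oneₛ

  assocF : (ℤ → ℤ → Series) → ℤ → ℤ → Series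
  assocF D p q = D p q *ₛ invₛ (D (- q) p)

  SameAssocF : (ℤ → ℤ → Series) → (ℤ → ℤ → Series) → Set (a ⊔ ℓ)
  SameAssocF D E = ∀ p q → InU p q → assocF D p q ≈ₛ assocF E p q

-- Right multiplication by the constant D(1,1)⁻¹ preserves both defining relations of a
-- Dedekind symbol and the associated function, and normalizes. For uniqueness, if D′ is
-- another normalized symbol with the same associated function, then
-- G(p,q) = D(p,q)⁻¹ D′(p,q) is invariant under (p,q) ↦ (p,p+q), because D and D′ both are,
-- and under (p,q) ↦ (-q,p), by equality of the associated functions. These two moves
-- connect every coprime pair to (1,1) (Euclid's algorithm), so G is constantly
-- G(1,1) = D(1,1)⁻¹.
module Submission where

open import Defs
open import Level using (Level; _⊔_)
open import Data.Nat as ℕ using (zero; suc)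
import Data.Nat.Properties as ℕ
import Data.Nat.Coprimality as ℕ
open import Data.Nat.Divisibility using (∣m∣n⇒∣m+n)
open import Data.Integer using (ℤ; +_; -[1+_]; -_; _+_; ∣_∣; 1ℤ)
open import Data.Integer.Properties
  using (neg-involutive; ∣-i∣≡∣i∣; neg-distrib-+; +-0-abelianGroup)
open import Data.List using (List; []; _∷_; map; length)
open import Data.List.Properties using (map-∘)
open import Data.List.Relation.Unary.All as All using (All; []; _∷_)
open import Data.List.Relation.Unary.All.Properties using (map⁺)
open import Data.Product using (Σ; _×_; _,_; proj₂)
open import Algebra.Bundles using (CommutativeRing; Monoid; AbelianGroup)
import Algebra.Properties.CommutativeSemigroup as CommutativeSemigroupProperties
import Algebra.Properties.Group as GroupProperties
import Algebra.Properties.Monoid as MonoidProperties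
open import Relation.Binary.Bundles using (Setoid)
open import Relation.Binary.PropositionalEquality as ≡ using (_≡_; subst; cong)
open import Relation.Nullary using (yes; no)
import Relation.Binary.Reasoning.Setoid as SetoidReasoning

coprime-+⁻ : ∀ {m n} → ℕ.Coprime (n ℕ.+ m) n → ℕ.Coprime m n
coprime-+⁻ c (d∣m , d∣n) = c (∣m∣n⇒∣m+n d∣n d∣m , d∣n)

InU-rotate : ∀ p q → InU p q → InU (- q) p
InU-rotate p q c = subst (λ n → ℕ.Coprime n ∣ p ∣) (≡.sym (∣-i∣≡∣i∣ q)) (ℕ.sym c)

InU-rotate⁻¹ : ∀ p q → InU p q → InU q (- p)
InU-rotate⁻¹ p q c = subst (ℕ.Coprime ∣ q ∣) (≡.sym (∣-i∣≡∣i∣ p)) (ℕ.sym c)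

InU-1-0 : InU 1ℤ (+ 0)
InU-1-0 = ℕ.1-coprimeTo 0

InU-1-1 : InU 1ℤ 1ℤ
InU-1-1 = ℕ.1-coprimeTo 1

i+-[i+j]≡-j : ∀ i j → i + - (i + j) ≡ - j
i+-[i+j]≡-j i j = ≡.trans (cong (λ k → i + k) (neg-distrib-+ i j)) (\\-leftDividesˡ i (- j))
  where open GroupProperties (AbelianGroup.group +-0-abelianGroup)

module _ {s ℓ} (S : Setoid s ℓ) where
  open Setoid S
  open SetoidReasoning S

  constant-on-U : (G : ℤ → ℤ → Carrier)
    → (∀ p q → InU p q → G p q ≈ G (- q) p)
    → (∀ p q → InU p q → G p q ≈ G p (p + q))
    → ∀ p q → InU p q → G p q ≈ G 1ℤ 1ℤ
  constant-on-U G rotate shift = on-U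
    where
    rotate⁻¹ : ∀ p q → InU p q → G p q ≈ G q (- p)
    rotate⁻¹ p q c = begin
      G p q       ≡⟨ cong (λ r → G r q) (neg-involutive p) ⟨
      G (- - p) q ≈⟨ rotate q (- p) (InU-rotate⁻¹ p q c) ⟨
      G q (- p)   ∎

    shift-first : ∀ p q → InU p q → InU (q + p) q → G (q + p) q ≈ G p q
    shift-first p q c c′ = begin
      G (q + p) q           ≈⟨ rotate⁻¹ (q + p) q c′ ⟩
      G q (- (q + p))       ≈⟨ shift q (- (q + p)) (InU-rotate⁻¹ (q + p) q c′) ⟩
      G q (q + - (q + p))   ≡⟨ cong (G q) (i+-[i+j]≡-j q p) ⟩
      G q (- p)             ≈⟨ rotate⁻¹ p q c ⟨
      G p q                 ∎

    at-1-0 : G 1ℤ (+ 0) ≈ G 1ℤ 1ℤ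
    at-1-0 = shift 1ℤ (+ 0) InU-1-0

    descend : ∀ n a b → a ℕ.+ b ℕ.≤ n → ℕ.Coprime a b → G (+ a) (+ b) ≈ G 1ℤ 1ℤ
    descend n zero b _ c with ℕ.0-coprimeTo-m⇒m≡1 c
    ... | ≡.refl = trans (sym (rotate 1ℤ (+ 0) InU-1-0)) at-1-0
    descend n (suc a) zero _ c with ℕ.0-coprimeTo-m⇒m≡1 (ℕ.sym c)
    ... | ≡.refl = at-1-0
    descend (suc n) (suc a) (suc b) (ℕ.s≤s a+b≤n) c with suc a ℕ.≤? suc b
    ... | yes a≤b with ℕ.m≤n⇒∃[o]m+o≡n a≤b
    ...   | k , ≡.refl = trans (sym (shift (+ suc a) (+ k) c′))
                               (descend n (suc a) k (ℕ.≤-trans (ℕ.m≤n+m _ a) a+b≤n) c′)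
      where c′ = ℕ.sym (coprime-+⁻ (ℕ.sym c))
    descend (suc n) (suc a) (suc b) (ℕ.s≤s a+b≤n) c | no a≰b
      with ℕ.m≤n⇒∃[o]m+o≡n (ℕ.<⇒≤ (ℕ.≰⇒> a≰b))
    ... | k , ≡.refl = trans (shift-first (+ k) (+ suc b) c′ c)
                             (descend n k (suc b) (ℕ.≤-trans (ℕ.+-monoˡ-≤ (suc b) k≤b+k) a+b≤n) c′)
      where
      c′ = coprime-+⁻ c
      k≤b+k = ℕ.m≤n+m k b

    on-quadrant : ∀ {a b} → ℕ.Coprime a b → G (+ a) (+ b) ≈ G 1ℤ 1ℤ
    on-quadrant {a} {b} = descend (a ℕ.+ b) a b ℕ.≤-refl

    on-U : ∀ p q → InU p q → G p q ≈ G 1ℤ 1ℤ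
    on-U (+ a) (+ b) c = on-quadrant c
    on-U (+ a) -[1+ b ] c =
      trans (rotate (+ a) -[1+ b ] c) (on-quadrant (InU-rotate (+ a) -[1+ b ] c))
    on-U -[1+ a ] (+ b) c =
      trans (rotate⁻¹ -[1+ a ] (+ b) c) (on-quadrant (InU-rotate⁻¹ -[1+ a ] (+ b) c))
    on-U -[1+ a ] -[1+ b ] c =
      trans (rotate -[1+ a ] -[1+ b ] c) (on-U (+ suc b) -[1+ a ] (InU-rotate -[1+ a ] -[1+ b ] c))

module PowerSeriesProperties {c ℓ a : Level} (R : CommutativeRing c ℓ) (A : Set a) where
  open PowerSeries R A
  open CommutativeRing R renaming (Carrier to K; _+_ to _+ᴿ_; _*_ to _*ᴿ_; -_ to -ᴿ_)
  open CommutativeSemigroupProperties +-commutativeSemigroup using (interchange)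

  module _ {x} {X : Set x} where

    sum-cong : {φ ψ : X → K} {l : List X} → All (λ s → φ s ≈ ψ s) l
             → sumᴿ (map φ l) ≈ sumᴿ (map ψ l)
    sum-cong []       = refl
    sum-cong (e ∷ es) = +-cong e (sum-cong es)

    sum-+ : (φ ψ : X → K) (l : List X)
          → sumᴿ (map (λ s → φ s +ᴿ ψ s) l) ≈ sumᴿ (map φ l) +ᴿ sumᴿ (map ψ l)
    sum-+ φ ψ []      = sym (+-identityˡ 0#)
    sum-+ φ ψ (s ∷ l) = trans (+-cong refl (sum-+ φ ψ l)) (interchange (φ s) (ψ s) _ _)

    sum-*ˡ : (k : K) (φ : X → K) (l : List X)
           → sumᴿ (map (λ s → k *ᴿ φ s) l) ≈ k *ᴿ sumᴿ (map φ l)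
    sum-*ˡ k φ []      = sym (zeroʳ k)
    sum-*ˡ k φ (s ∷ l) = trans (+-cong refl (sum-*ˡ k φ l)) (sym (distribˡ k (φ s) _))

  ≈ₛ-setoid : Setoid (a ⊔ c) (a ⊔ ℓ)
  ≈ₛ-setoid = record
    { Carrier = Series
    ; _≈_ = _≈ₛ_
    ; isEquivalence = record
      { refl = λ _ → refl
      ; sym = λ f≈g w → sym (f≈g w)
      ; trans = λ f≈g g≈h w → trans (f≈g w) (g≈h w)
      }
    }

  open Setoid ≈ₛ-setoid public using () renaming (refl to ≈ₛ-refl; sym to ≈ₛ-sym; trans to ≈ₛ-trans)

  ∂ : A → Series → Series
  ∂ x f w = f (x ∷ w)

  *ₛ-[] : ∀ f g → (f *ₛ g) [] ≈ f [] *ᴿ g []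
  *ₛ-[] f g = +-identityʳ _

  *ₛ-∷ : ∀ f g x w → (f *ₛ g) (x ∷ w) ≡ f [] *ᴿ g (x ∷ w) +ᴿ (∂ x f *ₛ g) w
  *ₛ-∷ f g x w = ≡.cong (λ t → f [] *ᴿ g (x ∷ w) +ᴿ sumᴿ t) (≡.sym (map-∘ (splits w)))

  *ₛ-cong : ∀ {f f′ g g′} → f ≈ₛ f′ → g ≈ₛ g′ → (f *ₛ g) ≈ₛ (f′ *ₛ g′)
  *ₛ-cong f≈f′ g≈g′ w = sum-cong (All.universal (λ (u , v) → *-cong (f≈f′ u) (g≈g′ v)) (splits w))

  *ₛ-linearˡ : ∀ k f g h w
    → ((λ u → k *ᴿ f u +ᴿ g u) *ₛ h) w ≈ k *ᴿ (f *ₛ h) w +ᴿ (g *ₛ h) w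
  *ₛ-linearˡ k f g h w = begin
      sumᴿ (map (λ (u , v) → (k *ᴿ f u +ᴿ g u) *ᴿ h v) (splits w))
    ≈⟨ sum-cong (All.universal (λ (u , v) →
         trans (distribʳ (h v) _ _) (+-cong (*-assoc k (f u) (h v)) refl)) (splits w)) ⟩
      sumᴿ (map (λ (u , v) → k *ᴿ (f u *ᴿ h v) +ᴿ g u *ᴿ h v) (splits w))
    ≈⟨ sum-+ _ _ (splits w) ⟩
      sumᴿ (map (λ (u , v) → k *ᴿ (f u *ᴿ h v)) (splits w)) +ᴿ (g *ₛ h) w
    ≈⟨ +-cong (sum-*ˡ k _ (splits w)) refl ⟩
      k *ᴿ (f *ₛ h) w +ᴿ (g *ₛ h) w
    ∎
    where open SetoidReasoning setoid

  *ₛ-assoc : ∀ f g h → ((f *ₛ g) *ₛ h) ≈ₛ (f *ₛ (g *ₛ h))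
  *ₛ-assoc f g h [] = begin
      ((f *ₛ g) *ₛ h) []       ≈⟨ trans (*ₛ-[] (f *ₛ g) h) (*-cong (*ₛ-[] f g) refl) ⟩
      (f [] *ᴿ g []) *ᴿ h []   ≈⟨ *-assoc _ _ _ ⟩
      f [] *ᴿ (g [] *ᴿ h [])   ≈⟨ trans (*ₛ-[] f (g *ₛ h)) (*-cong refl (*ₛ-[] g h)) ⟨
      (f *ₛ (g *ₛ h)) []       ∎
    where open SetoidReasoning setoid
  *ₛ-assoc f g h (x ∷ w) = begin
      ((f *ₛ g) *ₛ h) (x ∷ w)
    ≡⟨ *ₛ-∷ (f *ₛ g) h x w ⟩
      (f *ₛ g) [] *ᴿ h (x ∷ w) +ᴿ (∂ x (f *ₛ g) *ₛ h) w
    ≈⟨ +-cong (*-cong (*ₛ-[] f g) refl) (*ₛ-cong (λ u → reflexive (*ₛ-∷ f g x u)) ≈ₛ-refl w) ⟩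
      (f [] *ᴿ g []) *ᴿ h (x ∷ w) +ᴿ ((λ u → f [] *ᴿ ∂ x g u +ᴿ (∂ x f *ₛ g) u) *ₛ h) w
    ≈⟨ +-cong (*-assoc _ _ _) (*ₛ-linearˡ (f []) (∂ x g) (∂ x f *ₛ g) h w) ⟩
      f [] *ᴿ (g [] *ᴿ h (x ∷ w)) +ᴿ (f [] *ᴿ (∂ x g *ₛ h) w +ᴿ ((∂ x f *ₛ g) *ₛ h) w)
    ≈⟨ +-assoc _ _ _ ⟨
      (f [] *ᴿ (g [] *ᴿ h (x ∷ w)) +ᴿ f [] *ᴿ (∂ x g *ₛ h) w) +ᴿ ((∂ x f *ₛ g) *ₛ h) w
    ≈⟨ +-cong (sym (distribˡ _ _ _)) (*ₛ-assoc (∂ x f) g h w) ⟩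
      f [] *ᴿ (g [] *ᴿ h (x ∷ w) +ᴿ (∂ x g *ₛ h) w) +ᴿ (∂ x f *ₛ (g *ₛ h)) w
    ≡⟨ ≡.cong (λ t → f [] *ᴿ t +ᴿ (∂ x f *ₛ (g *ₛ h)) w) (*ₛ-∷ g h x w) ⟨
      f [] *ᴿ (g *ₛ h) (x ∷ w) +ᴿ (∂ x f *ₛ (g *ₛ h)) w
    ≡⟨ *ₛ-∷ f (g *ₛ h) x w ⟨
      (f *ₛ (g *ₛ h)) (x ∷ w)
    ∎
    where open SetoidReasoning setoid

  *ₛ-identityˡ : ∀ f → (oneₛ *ₛ f) ≈ₛ f
  *ₛ-identityˡ f [] = trans (*ₛ-[] oneₛ f) (*-identityˡ _)
  *ₛ-identityˡ f (x ∷ w) = begin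
      (oneₛ *ₛ f) (x ∷ w)
    ≡⟨ *ₛ-∷ oneₛ f x w ⟩
      1# *ᴿ f (x ∷ w) +ᴿ sumᴿ (map (λ (u , v) → 0# *ᴿ f v) (splits w))
    ≈⟨ +-cong (*-identityˡ _) (trans (sum-*ˡ 0# _ (splits w)) (zeroˡ _)) ⟩
      f (x ∷ w) +ᴿ 0#
    ≈⟨ +-identityʳ _ ⟩
      f (x ∷ w)
    ∎
    where open SetoidReasoning setoid

  *ₛ-identityʳ : ∀ f → (f *ₛ oneₛ) ≈ₛ f
  *ₛ-identityʳ f [] = trans (*ₛ-[] f oneₛ) (*-identityʳ _)
  *ₛ-identityʳ f (x ∷ w) = begin
      (f *ₛ oneₛ) (x ∷ w)              ≡⟨ *ₛ-∷ f oneₛ x w ⟩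
      f [] *ᴿ 0# +ᴿ (∂ x f *ₛ oneₛ) w  ≈⟨ +-cong (zeroʳ _) (*ₛ-identityʳ (∂ x f) w) ⟩
      0# +ᴿ f (x ∷ w)                  ≈⟨ +-identityˡ _ ⟩
      f (x ∷ w)                        ∎
    where open SetoidReasoning setoid

  *ₛ-monoid : Monoid (a ⊔ c) (a ⊔ ℓ)
  *ₛ-monoid = record
    { Carrier = Series
    ; _≈_ = _≈ₛ_
    ; _∙_ = _*ₛ_
    ; ε = oneₛ
    ; isMonoid = record
      { isSemigroup = record
        { isMagma = record
          { isEquivalence = Setoid.isEquivalence ≈ₛ-setoid
          ; ∙-cong = *ₛ-cong
          }
        ; assoc = *ₛ-assoc
        }
      ; identity = *ₛ-identityˡ , *ₛ-identityʳ
      }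
    }

  open MonoidProperties *ₛ-monoid using (elimˡ; cancelˡ; cancelʳ; insertˡ; insertʳ; cancelᶜ)
  open SetoidReasoning ≈ₛ-setoid

  ConstantOne : Series → Set ℓ
  ConstantOne f = f [] ≈ 1#

  *ₛ-constantOne : ∀ f g → ConstantOne f → ConstantOne g → ConstantOne (f *ₛ g)
  *ₛ-constantOne f g f₀ g₀ = trans (*ₛ-[] f g) (trans (*-cong f₀ g₀) (*-identityʳ 1#))

  splits-suffix-≤ : ∀ w → All (λ (u , v) → length v ℕ.≤ length w) (splits w)
  splits-suffix-≤ []      = ℕ.z≤n ∷ []
  splits-suffix-≤ (x ∷ w) = ℕ.≤-refl ∷ map⁺ (All.map ℕ.m≤n⇒m≤1+n (splits-suffix-≤ w))

  invAux-fuel : ∀ f {m n} w → length w ℕ.≤ m → length w ℕ.≤ n → invAux m f w ≈ invAux n f w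
  invAux-fuel f []      _          _          = refl
  invAux-fuel f (x ∷ w) (ℕ.s≤s w≤m) (ℕ.s≤s w≤n) = -‿cong (sum-cong (All.map
    (λ {s} v≤w → *-cong refl (invAux-fuel f (proj₂ s) (ℕ.≤-trans v≤w w≤m) (ℕ.≤-trans v≤w w≤n)))
    (splits-suffix-≤ w)))

  invₛ-∷ : ∀ f x w → invₛ f (x ∷ w) ≈ -ᴿ (∂ x f *ₛ invₛ f) w
  invₛ-∷ f x w = -‿cong (sum-cong (All.map
    (λ {s} v≤w → *-cong refl (invAux-fuel f (proj₂ s) v≤w ℕ.≤-refl))
    (splits-suffix-≤ w)))

  *ₛ-inverseʳ : ∀ {f} → ConstantOne f → (f *ₛ invₛ f) ≈ₛ oneₛ
  *ₛ-inverseʳ {f} f₀ [] = trans (*ₛ-[] f (invₛ f)) (trans (*-identityʳ _) f₀)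
  *ₛ-inverseʳ {f} f₀ (x ∷ w) = R.begin
      (f *ₛ invₛ f) (x ∷ w)               R.≡⟨ *ₛ-∷ f (invₛ f) x w ⟩
      f [] *ᴿ invₛ f (x ∷ w) +ᴿ S         R.≈⟨ +-cong (*-cong f₀ (invₛ-∷ f x w)) refl ⟩
      1# *ᴿ (-ᴿ S) +ᴿ S                   R.≈⟨ +-cong (*-identityˡ _) refl ⟩
      -ᴿ S +ᴿ S                           R.≈⟨ -‿inverseˡ S ⟩
      0#                                  R.∎
    where
    module R = SetoidReasoning setoid
    S = (∂ x f *ₛ invₛ f) w

  -- f is a left and invₛ (invₛ f) a right inverse of invₛ f, so the two coincide.
  *ₛ-inverseˡ : ∀ {f} → ConstantOne f → (invₛ f *ₛ f) ≈ₛ oneₛ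
  *ₛ-inverseˡ {f} f₀ = begin
      invₛ f *ₛ f               ≈⟨ *ₛ-cong ≈ₛ-refl f≈invinv ⟩
      invₛ f *ₛ invₛ (invₛ f)   ≈⟨ *ₛ-inverseʳ {invₛ f} refl ⟩
      oneₛ                      ∎
    where
    f≈invinv : f ≈ₛ invₛ (invₛ f)
    f≈invinv = ≈ₛ-trans
      (≈ₛ-sym (cancelʳ (*ₛ-inverseʳ {invₛ f} refl) f))
      (elimˡ (*ₛ-inverseʳ f₀) (invₛ (invₛ f)))

  invₛ-unique : ∀ {f g} → ConstantOne f → (f *ₛ g) ≈ₛ oneₛ → g ≈ₛ invₛ f
  invₛ-unique {f} {g} f₀ fg≈1 = begin
      g                     ≈⟨ insertˡ (*ₛ-inverseˡ f₀) g ⟩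
      invₛ f *ₛ (f *ₛ g)    ≈⟨ *ₛ-cong ≈ₛ-refl fg≈1 ⟩
      invₛ f *ₛ oneₛ        ≈⟨ *ₛ-identityʳ (invₛ f) ⟩
      invₛ f                ∎

  invₛ-cong : ∀ {f g} → ConstantOne f → f ≈ₛ g → invₛ f ≈ₛ invₛ g
  invₛ-cong {f} {g} f₀ f≈g = invₛ-unique (trans (sym (f≈g [])) f₀)
    (≈ₛ-trans (*ₛ-cong (≈ₛ-sym f≈g) ≈ₛ-refl) (*ₛ-inverseʳ f₀))

  invₛ-anti-homo-*ₛ : ∀ {f g} → ConstantOne f → ConstantOne g → invₛ (f *ₛ g) ≈ₛ (invₛ g *ₛ invₛ f)
  invₛ-anti-homo-*ₛ {f} {g} f₀ g₀ = ≈ₛ-sym (invₛ-unique (*ₛ-constantOne f g f₀ g₀) (begin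
      (f *ₛ g) *ₛ (invₛ g *ₛ invₛ f)   ≈⟨ cancelᶜ (*ₛ-inverseʳ g₀) f (invₛ f) ⟩
      f *ₛ invₛ f                      ≈⟨ *ₛ-inverseʳ f₀ ⟩
      oneₛ                             ∎))

  *ₛ-invₛ-cancelʳ : ∀ f g h → ConstantOne g → ConstantOne h
    → ((f *ₛ h) *ₛ invₛ (g *ₛ h)) ≈ₛ (f *ₛ invₛ g)
  *ₛ-invₛ-cancelʳ f g h g₀ h₀ = begin
      (f *ₛ h) *ₛ invₛ (g *ₛ h)        ≈⟨ *ₛ-cong ≈ₛ-refl (invₛ-anti-homo-*ₛ g₀ h₀) ⟩
      (f *ₛ h) *ₛ (invₛ h *ₛ invₛ g)   ≈⟨ cancelᶜ (*ₛ-inverseʳ h₀) f (invₛ g) ⟩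
      f *ₛ invₛ g                      ∎

  *ₛ-invₛ-transpose : ∀ f g h k → ConstantOne g → ConstantOne h
    → (f *ₛ invₛ g) ≈ₛ (h *ₛ invₛ k) → (invₛ h *ₛ f) ≈ₛ (invₛ k *ₛ g)
  *ₛ-invₛ-transpose f g h k g₀ h₀ fg⁻¹≈hk⁻¹ = begin
      invₛ h *ₛ f                       ≈⟨ *ₛ-cong ≈ₛ-refl (insertʳ (*ₛ-inverseˡ g₀) f) ⟩
      invₛ h *ₛ ((f *ₛ invₛ g) *ₛ g)    ≈⟨ *ₛ-cong ≈ₛ-refl (*ₛ-cong fg⁻¹≈hk⁻¹ ≈ₛ-refl) ⟩
      invₛ h *ₛ ((h *ₛ invₛ k) *ₛ g)    ≈⟨ *ₛ-cong ≈ₛ-refl (*ₛ-assoc h (invₛ k) g) ⟩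
      invₛ h *ₛ (h *ₛ (invₛ k *ₛ g))    ≈⟨ cancelˡ (*ₛ-inverseˡ h₀) (invₛ k *ₛ g) ⟩
      invₛ k *ₛ g                       ∎

module Normalization {c ℓ a : Level} (R : CommutativeRing c ℓ) (A : Set a) where
  open PowerSeries R A
  open PowerSeriesProperties R A
  open CommutativeRing R using (refl)
  open MonoidProperties *ₛ-monoid using (insertˡ)
  open SetoidReasoning ≈ₛ-setoid

  normalize : (ℤ → ℤ → Series) → ℤ → ℤ → Series
  normalize D p q = D p q *ₛ invₛ (D 1ℤ 1ℤ)

  module _ {D : ℤ → ℤ → Series} (D-symbol : IsMultipleDedekindSymbol D) where
    open IsMultipleDedekindSymbol D-symbol

    normalize-isSymbol : IsMultipleDedekindSymbol (normalize D)
    normalize-isSymbol = record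
      { constant-one = λ p q pq → *ₛ-constantOne (D p q) (invₛ (D 1ℤ 1ℤ))
                                    (constant-one p q pq) refl
      ; neg-sym      = λ p q pq → *ₛ-cong (neg-sym p q pq) ≈ₛ-refl
      ; shift        = λ p q pq → *ₛ-cong (shift p q pq) ≈ₛ-refl
      }

    normalize-normalized : Normalized (normalize D)
    normalize-normalized = *ₛ-inverseʳ (constant-one 1ℤ 1ℤ InU-1-1)

    normalize-sameAssocF : SameAssocF (normalize D) D
    normalize-sameAssocF p q pq = *ₛ-invₛ-cancelʳ (D p q) (D (- q) p) (invₛ (D 1ℤ 1ℤ))
      (constant-one (- q) p (InU-rotate p q pq)) refl

    normalized-unique : (D′ : ℤ → ℤ → Series) → IsMultipleDedekindSymbol D′ → Normalized D′
      → SameAssocF D′ D → ∀ p q → InU p q → D′ p q ≈ₛ normalize D p q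
    normalized-unique D′ D′-symbol D′-normalized D′-assocF p q pq = begin
        D′ p q
      ≈⟨ insertˡ (*ₛ-inverseʳ (constant-one p q pq)) (D′ p q) ⟩
        D p q *ₛ G p q
      ≈⟨ *ₛ-cong ≈ₛ-refl (constant-on-U ≈ₛ-setoid G G-rotate G-shift p q pq) ⟩
        D p q *ₛ G 1ℤ 1ℤ
      ≈⟨ *ₛ-cong ≈ₛ-refl (*ₛ-cong ≈ₛ-refl D′-normalized) ⟩
        D p q *ₛ (invₛ (D 1ℤ 1ℤ) *ₛ oneₛ)
      ≈⟨ *ₛ-cong ≈ₛ-refl (*ₛ-identityʳ _) ⟩
        normalize D p q
      ∎
      where
      module D′ = IsMultipleDedekindSymbol D′-symbol

      G : ℤ → ℤ → Series
      G p q = invₛ (D p q) *ₛ D′ p q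

      G-rotate : ∀ p q → InU p q → G p q ≈ₛ G (- q) p
      G-rotate p q pq = *ₛ-invₛ-transpose (D′ p q) (D′ (- q) p) (D p q) (D (- q) p)
        (D′.constant-one (- q) p (InU-rotate p q pq)) (constant-one p q pq) (D′-assocF p q pq)

      G-shift : ∀ p q → InU p q → G p q ≈ₛ G p (p + q)
      G-shift p q pq = *ₛ-cong (invₛ-cong (constant-one p q pq) (shift p q pq)) (D′.shift p q pq)

lemma3p2 : {c ℓ a : Level} (R : CommutativeRing c ℓ) (A : Set a)
    → let open PowerSeries R A in
      (D : ℤ → ℤ → Series) → IsMultipleDedekindSymbol D
    → Σ (ℤ → ℤ → Series) (λ D̃ →
        IsMultipleDedekindSymbol D̃ × Normalized D̃ × SameAssocF D̃ D
        × ((D′ : ℤ → ℤ → Series) → IsMultipleDedekindSymbol D′ → Normalized D′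
           → SameAssocF D′ D → ∀ p q → InU p q → D′ p q ≈ₛ D̃ p q))
lemma3p2 R A D D-symbol =
    normalize D
  , normalize-isSymbol D-symbol
  , normalize-normalized D-symbol
  , normalize-sameAssocF D-symbol
  , normalized-unique D-symbol
  where open Normalization R A
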